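{- Let $n\ge 2$ and let $T$ be any tree on $\lfloor n/2\rfloor+1$ vertices. Suppose two players alternately claim previously unclaimed edges of $K_n$, neither being allowed to claim an edge that creates a cycle in the graph of claimed edges, until no further edge can be claimed. Then either player (regardless of which player starts) has a strategy guaranteeing that the final graph of claimed edges contains a subgraph isomorphic to $T$. -}

module Defs where

open import Data.Nat using (ℕ; _≤_; _<_)
open import Data.Fin using (Fin; toℕ)
open import Data.Bool using (Bool; true; false)
open import Data.Product using (Σ; ∃; _×_; _,_; proj₁; proj₂)
open import Data.Sum using (_⊎_)
open import Data.List using (List; []; _∷_; _++_; [_]; length)
open import Data.List.Membership.Propositional using (_∈_)
open import Data.List.Relation.Unary.All using (All)
open import Data.List.Relation.Unary.Linked using (Linked)
open import Data.List.Relation.Unary.Unique.Propositional using (Unique)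
open import Relation.Binary.PropositionalEquality using (_≡_; _≢_)
open import Relation.Nullary using (¬_)
open import Function.Definitions using (Injective)

Edge : ℕ → Set
Edge k = Fin k × Fin k

EdgeList : ℕ → Set
EdgeList k = List (Edge k)

Adj : ∀ {k} → EdgeList k → Fin k → Fin k → Set
Adj E u v = (u , v) ∈ E ⊎ (v , u) ∈ E

-- A cycle: distinct vertices x, v1, ..., vr (r ≥ 2, so at least 3 vertices),
-- consecutive ones adjacent, and the last adjacent to x.
HasCycle : ∀ {k} → EdgeList k → Set
HasCycle {k} E =
  Σ (Fin k) λ x → Σ (List (Fin k)) λ xs →
    (2 ≤ length xs) × Unique (x ∷ xs) × Linked (Adj E) (x ∷ xs ++ [ x ])

Acyclic : ∀ {k} → EdgeList k → Set
Acyclic E = ¬ HasCycle E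

data Reach {k} (E : EdgeList k) : Fin k → Fin k → Set where
  here : ∀ {u} → Reach E u u
  step : ∀ {u w v} → Adj E u w → Reach E w v → Reach E u v

Connected : ∀ {k} → EdgeList k → Set
Connected {k} E = (u v : Fin k) → Reach E u v

Loopless : ∀ {k} → EdgeList k → Set
Loopless E = All (λ e → proj₁ e ≢ proj₂ e) E

IsTree : ∀ {m} → EdgeList m → Set
IsTree T = Loopless T × Connected T × Acyclic T

ContainsCopy : ∀ {m n} → EdgeList m → EdgeList n → Set
ContainsCopy {m} {n} T G =
  Σ (Fin m → Fin n) λ f → Injective _≡_ _≡_ f ×
    All (λ e → Adj G (f (proj₁ e)) (f (proj₂ e))) T

-- An edge {i,j} of K_n is represented as (i , j) with i < j.
Legal : ∀ {n} → EdgeList n → Edge n → Set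
Legal G e = (toℕ (proj₁ e) < toℕ (proj₂ e)) × ¬ (e ∈ G) × Acyclic (e ∷ G)

Ended : ∀ {n} → EdgeList n → Set
Ended G = ∀ e → ¬ Legal G e

-- Forces T myTurn G : the player ("me") can guarantee, from position G
-- (claimed edges G, with myTurn = true iff it is my move), that the final
-- graph of claimed edges contains a copy of T.  Being an inductive type,
-- this is exactly the existence of a winning strategy in the finite game.
data Forces {m n} (T : EdgeList m) : Bool → EdgeList n → Set where
  done   : ∀ {b G} → Ended G → ContainsCopy T G → Forces T b G
  mine   : ∀ {G} e → Legal G e → Forces T false (e ∷ G) → Forces T true G
  theirs : ∀ {G} → (∃ λ e → Legal G e) →
           (∀ e → Legal G e → Forces T true (e ∷ G)) → Forces T false G

{-# OPTIONS --safe #-}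
-- Maker, the player whose strategy is built, keeps an embedding φ of a T-connected vertex set Dom
-- of T into the component of the claimed forest that contains the image of a fixed root, and watches
-- Φ = 2 |Dom| + c, where c is the number of components of the forest.  Every legal move joins two
-- components, so it lowers c by one.  On her turn Maker takes a T-edge uw leaving Dom and claims an
-- edge from φ u to a vertex z outside the root's component, extending φ by w ↦ z; as T is a tree,
-- u is the only T-neighbour of w in Dom, so φ stays an embedding, and Φ rises by one.  Once Dom is
-- all of T she joins components arbitrarily.  Hence Φ ≥ 2k whenever Maker is to move and Φ > 2k
-- whenever the opponent is.  The game ends exactly when the forest is connected, i.e. c = 1, and
-- then 2 |Dom| ≥ 2k - 1 forces Dom = T.  Initially Φ = 2 + n ≥ 2k when Maker starts from a single
-- vertex; when the opponent starts, Maker maps an edge of T onto his first edge, giving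
-- Φ = 4 + (n - 1).

module Submission where

open import Defs
open import Level using (Level; 0ℓ; _⊔_)
open import Function using (_∘_; id; const)
open import Data.Bool using (Bool; true; false)
open import Data.Nat using (ℕ; zero; suc; _+_; _*_; _≤_; _<_; z≤n; s≤s; s≤s⁻¹; ⌊_/2⌋; ⌈_/2⌉)
open import Data.Nat.Tactic.RingSolver using (solve-∀)
open import Data.Nat.Properties using (m≤n⇒m≤1+n; ≤-antisym; suc-injective; <-irrefl; <-asym; <-cmp; ≮⇒≥; <⇒≤; <⇒≱; ≤-reflexive; ≤-trans; n≤1+n; +-suc; +-monoʳ-≤; *-monoʳ-≤; m<m+n; ⌊n/2⌋≤⌈n/2⌉; ⌊n/2⌋+⌈n/2⌉≡n; module ≤-Reasoning)
open import Data.Fin using (Fin; zero; suc; toℕ; _↑ʳ_)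
import Data.Fin.Properties as Fin
open import Data.Fin.Properties using (all?; ¬∀⟶∃¬)
open import Data.Product as Product using (∃; ∃₂; _×_; _,_; proj₁; proj₂)
open import Data.Sum as Sum using (_⊎_; inj₁; inj₂; [_,_]′)
open import Data.List using (List; []; _∷_; _++_; [_]; length)
open import Data.List.Properties using (++-assoc)
open import Data.List.Membership.Propositional using (_∈_)
open import Data.List.Membership.Propositional.Properties using (∈-∃++)
open import Data.List.Relation.Unary.Any using (here; there; any?)
open import Data.List.Relation.Unary.All as All using (All; []; _∷_)
open import Data.List.Relation.Unary.All.Properties using (¬Any⇒All¬) renaming (++⁺ to All-++⁺)
open import Data.List.Relation.Unary.AllPairs using ([]; _∷_)
open import Data.List.Relation.Unary.Linked as Linked using (Linked; []; [-]; _∷_)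
open import Data.List.Relation.Unary.Unique.Propositional using (Unique)
open import Data.Vec.Functional using (updateAt)
open import Data.Vec.Functional.Properties using (updateAt-updates; updateAt-minimal)
open import Relation.Binary.Core using (Rel)
open import Relation.Binary.Definitions using (DecidableEquality; tri<; tri≈; tri>)
open import Relation.Binary.PropositionalEquality
  using (_≡_; _≢_; refl; sym; trans; cong; subst; subst₂; setoid)
open import Relation.Binary.Construct.Closure.ReflexiveTransitive as Star using (Star; ε; _◅_; _◅◅_)
open import Relation.Nullary using (¬_; Dec; yes; no; contradiction)
open import Relation.Nullary.Decidable using (map′; _⊎-dec_; decidable-stable)
open import Relation.Unary using (Pred; Decidable; _⊆_)
open import Relation.Unary.Properties using (∅?)

private variable
  α ℓ p q : Level
  A : Set α
  k : ℕ
  E G : EdgeList k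
  a b u v w x y z : Fin k

-- Counting decidable subsets of Fin n

count : ∀ {n} {P : Pred (Fin n) p} → Decidable P → ℕ
count {n = zero}  P? = 0
count {n = suc n} P? with P? zero
... | yes _ = suc (count (P? ∘ suc))
... | no  _ = count (P? ∘ suc)

count≤n : ∀ {n} {P : Pred (Fin n) p} (P? : Decidable P) → count P? ≤ n
count≤n {n = zero}  P? = z≤n
count≤n {n = suc n} P? with P? zero
... | yes _ = s≤s (count≤n (P? ∘ suc))
... | no  _ = m≤n⇒m≤1+n (count≤n (P? ∘ suc))

count<n : ∀ {n} {P : Pred (Fin n) p} (P? : Decidable P) {v} → ¬ P v → count P? < n
count<n P? {zero} ¬Pv with P? zero
... | yes Pv = contradiction Pv ¬Pv
... | no  _  = s≤s (count≤n (P? ∘ suc))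
count<n P? {suc v} ¬Pv with P? zero
... | yes _ = s≤s (count<n (P? ∘ suc) ¬Pv)
... | no  _ = m≤n⇒m≤1+n (count<n (P? ∘ suc) ¬Pv)

count-all : ∀ {n} {P : Pred (Fin n) p} (P? : Decidable P) → (∀ v → P v) → count P? ≡ n
count-all {n = zero}  P? all = refl
count-all {n = suc n} P? all with P? zero
... | yes _  = cong suc (count-all (P? ∘ suc) (all ∘ suc))
... | no ¬P0 = contradiction (all zero) ¬P0

count-none : ∀ {n} {P : Pred (Fin n) p} (P? : Decidable P) → (∀ v → ¬ P v) → count P? ≡ 0
count-none {n = zero}  P? none = refl
count-none {n = suc n} P? none with P? zero
... | yes P0 = contradiction P0 (none zero)
... | no  _  = count-none (P? ∘ suc) (none ∘ suc)

count-mono : ∀ {n} {P : Pred (Fin n) p} {Q : Pred (Fin n) q} (P? : Decidable P) (Q? : Decidable Q) →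
             P ⊆ Q → count P? ≤ count Q?
count-mono {n = zero}  P? Q? P⊆Q = z≤n
count-mono {n = suc n} P? Q? P⊆Q with P? zero | Q? zero
... | yes _  | yes _  = s≤s (count-mono (P? ∘ suc) (Q? ∘ suc) P⊆Q)
... | yes P0 | no ¬Q0 = contradiction (P⊆Q P0) ¬Q0
... | no  _  | yes _  = m≤n⇒m≤1+n (count-mono (P? ∘ suc) (Q? ∘ suc) P⊆Q)
... | no  _  | no  _  = count-mono (P? ∘ suc) (Q? ∘ suc) P⊆Q

count-cong : ∀ {n} {P : Pred (Fin n) p} {Q : Pred (Fin n) q} (P? : Decidable P) (Q? : Decidable Q) →
             P ⊆ Q → Q ⊆ P → count P? ≡ count Q?
count-cong P? Q? P⊆Q Q⊆P = ≤-antisym (count-mono P? Q? P⊆Q) (count-mono Q? P? Q⊆P)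

count-insert : ∀ {n} {P : Pred (Fin n) p} {Q : Pred (Fin n) q} (P? : Decidable P) (Q? : Decidable Q) {r} →
               P r → ¬ Q r → (∀ {v} → v ≢ r → P v → Q v) → Q ⊆ P → count P? ≡ suc (count Q?)
count-insert {n = suc n} P? Q? {zero} Pr ¬Qr P⊆Q Q⊆P with P? zero | Q? zero
... | no ¬P0 | _      = contradiction Pr ¬P0
... | yes _  | yes Q0 = contradiction Q0 ¬Qr
... | yes _  | no  _  = cong suc (count-cong (P? ∘ suc) (Q? ∘ suc) (P⊆Q λ ()) Q⊆P)
count-insert {n = suc n} P? Q? {suc r} Pr ¬Qr P⊆Q Q⊆P with P? zero | Q? zero
... | yes _  | yes _  = cong suc (count-insert (P? ∘ suc) (Q? ∘ suc) Pr ¬Qr (λ v≢r → P⊆Q (v≢r ∘ Fin.suc-injective)) Q⊆P)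
... | no  _  | no  _  = count-insert (P? ∘ suc) (Q? ∘ suc) Pr ¬Qr (λ v≢r → P⊆Q (v≢r ∘ Fin.suc-injective)) Q⊆P
... | yes P0 | no ¬Q0 = contradiction (P⊆Q (λ ()) P0) ¬Q0
... | no ¬P0 | yes Q0 = contradiction (Q⊆P Q0) ¬P0

count-singleton : ∀ {n} (r : Fin n) → count (Fin._≟ r) ≡ 1
count-singleton {n} r =
  trans (count-insert (Fin._≟ r) (∅? {A = Fin n}) refl (λ ()) (λ v≢r v≡r → v≢r v≡r) λ ())
        (cong suc (count-none (∅? {A = Fin n}) λ _ ()))

-- Paths and cycles

module _ {R : Rel A ℓ} where

  Linked-split : ∀ xs {y ys} → Linked R (xs ++ y ∷ ys) → Linked R (xs ++ [ y ]) × Linked R (y ∷ ys)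
  Linked-split []               l       = [-] , l
  Linked-split (x ∷ [])         (r ∷ l) = r ∷ [-] , l
  Linked-split (x ∷ xs@(_ ∷ _)) (r ∷ l) with Linked-split xs l
  ... | l₁ , l₂ = r ∷ l₁ , l₂

  Linked-glue : ∀ xs {y ys} → Linked R (xs ++ [ y ]) → Linked R (y ∷ ys) → Linked R (xs ++ y ∷ ys)
  Linked-glue []               _         l = l
  Linked-glue (x ∷ [])         (r ∷ [-]) l = r ∷ l
  Linked-glue (x ∷ xs@(_ ∷ _)) (r ∷ l₁)  l = r ∷ Linked-glue xs l₁ l

  Linked⇒Star : ∀ {x y} vs → Linked R (x ∷ vs ++ [ y ]) → Star R x y
  Linked⇒Star []       (r ∷ [-]) = r ◅ ε
  Linked⇒Star (_ ∷ vs) (r ∷ l)   = r ◅ Linked⇒Star vs l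

data Path {A : Set α} (R : Rel A ℓ) : A → A → List A → Set (α ⊔ ℓ) where
  []  : ∀ {u} → Path R u u []
  _∷_ : ∀ {u w v vs} → R u w → Path R w v vs → Path R u v (w ∷ vs)

module _ {A : Set α} {R : Rel A ℓ} where

  Path-close : ∀ {u v c vs} → Path R u v vs → R v c → Linked R (u ∷ vs ++ [ c ])
  Path-close []      r = r ∷ [-]
  Path-close (s ∷ p) r = s ∷ Path-close p r

  Path-map : ∀ {S : Rel A q} → (∀ {x y} → R x y → S x y) → ∀ {u v vs} → Path R u v vs → Path S u v vs
  Path-map f []      = []
  Path-map f (r ∷ p) = f r ∷ Path-map f p

  Path-targets : ∀ {P : Pred A q} → (∀ {x y} → R x y → P y) → ∀ {u v vs} → Path R u v vs → All P vs
  Path-targets f []      = []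
  Path-targets f (r ∷ p) = f r ∷ Path-targets f p

  SimplePath : A → A → Set (α ⊔ ℓ)
  SimplePath u v = ∃ λ vs → Path R u v vs × Unique (u ∷ vs)

  module _ (_≟_ : DecidableEquality A) where

    Path-suffix : ∀ {u w v vs} → u ∈ w ∷ vs → Path R w v vs → Unique (w ∷ vs) → SimplePath u v
    Path-suffix (here refl) p       un       = _ , p , un
    Path-suffix (there u∈)  (_ ∷ p) (_ ∷ un) = Path-suffix u∈ p un

    loop-erase : ∀ {u v} → Star R u v → SimplePath u v
    loop-erase ε = [] , [] , [] ∷ []
    loop-erase {u} (_◅_ {j = w} r rs) with loop-erase rs
    ... | vs , p , un with any? (u ≟_) (w ∷ vs)
    ...   | yes u∈ = Path-suffix u∈ p un
    ...   | no  u∉ = w ∷ vs , r ∷ p , ¬Any⇒All¬ _ u∉ ∷ un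

Cycle : {A : Set α} → Rel A ℓ → A → List A → Set (α ⊔ ℓ)
Cycle R x xs = 2 ≤ length xs × Unique (x ∷ xs) × Linked R (x ∷ xs ++ [ x ])

module _ {A : Set α} where
  open import Data.List.Relation.Binary.Permutation.Setoid (setoid A) using (_↭_)
  open import Data.List.Relation.Binary.Permutation.Setoid.Properties (setoid A)
    using (++-comm; Unique-resp-↭; xs↭ys⇒|xs|≡|ys|)

  Cycle-rotate : ∀ {R : Rel A ℓ} {x xs y} → y ∈ x ∷ xs → Cycle R x xs → ∃ (Cycle R y)
  Cycle-rotate (here refl) cycle = _ , cycle
  Cycle-rotate {R = R} {x} {y = y} (there y∈xs) (len , un , lk) with ∈-∃++ y∈xs
  ... | P , S , refl = S ++ x ∷ P , len′ , Unique-resp-↭ rotation un , lk′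
    where
    rotation : (x ∷ P) ++ (y ∷ S) ↭ (y ∷ S) ++ (x ∷ P)
    rotation = ++-comm (x ∷ P) (y ∷ S)
    len′ : 2 ≤ length (S ++ x ∷ P)
    len′ = subst (2 ≤_) (suc-injective (xs↭ys⇒|xs|≡|ys| rotation)) len
    halves : Linked R ((x ∷ P) ++ [ y ]) × Linked R (y ∷ S ++ [ x ])
    halves = Linked-split (x ∷ P) (subst (Linked R) (cong (x ∷_) (++-assoc P (y ∷ S) [ x ])) lk)
    lk′ : Linked R (y ∷ (S ++ x ∷ P) ++ [ y ])
    lk′ = subst (Linked R) (cong (y ∷_) (sym (++-assoc S (x ∷ P) [ y ])))
                (Linked-glue (y ∷ S) (proj₂ halves) (proj₁ halves))

module _ {R : Rel A ℓ} where

  Star-exit : ∀ {P : Pred A p} → Decidable P → ∀ {x y} → Star R x y → P x → ¬ P y →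
              ∃₂ λ u w → R u w × P u × ¬ P w
  Star-exit P? ε                  Px ¬Py = contradiction Px ¬Py
  Star-exit P? (_◅_ {j = w} r rs) Px ¬Py with P? w
  ... | yes Pw  = Star-exit P? rs Pw ¬Py
  ... | no  ¬Pw = _ , _ , r , Px , ¬Pw

  Star-first : ∀ {x y} → Star R x y → x ≢ y → ∃₂ R
  Star-first ε       x≢y = contradiction refl x≢y
  Star-first (r ◅ _) _   = _ , _ , r

-- Forests

Walk : EdgeList k → Rel (Fin k) 0ℓ
Walk E = Star (Adj E)

Adj-sym : Adj E u v → Adj E v u
Adj-sym (inj₁ uv∈E) = inj₂ uv∈E
Adj-sym (inj₂ vu∈E) = inj₁ vu∈E

Adj-∷ : ∀ {e} → Adj E u v → Adj (e ∷ E) u v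
Adj-∷ (inj₁ uv∈E) = inj₁ (there uv∈E)
Adj-∷ (inj₂ vu∈E) = inj₂ (there vu∈E)

Adj-∷⁻ : Adj ((a , b) ∷ G) u v → Adj G u v ⊎ (u ≡ a × v ≡ b) ⊎ (u ≡ b × v ≡ a)
Adj-∷⁻ (inj₁ (here refl))  = inj₂ (inj₁ (refl , refl))
Adj-∷⁻ (inj₁ (there uv∈G)) = inj₁ (inj₁ uv∈G)
Adj-∷⁻ (inj₂ (here refl))  = inj₂ (inj₂ (refl , refl))
Adj-∷⁻ (inj₂ (there vu∈G)) = inj₁ (inj₂ vu∈G)

Adj-∷-avoid : a ≢ u → a ≢ v → Adj ((a , b) ∷ G) u v → Adj G u v
Adj-∷-avoid a≢u a≢v (inj₁ (here refl))  = contradiction refl a≢u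
Adj-∷-avoid a≢u a≢v (inj₁ (there uv∈G)) = inj₁ uv∈G
Adj-∷-avoid a≢u a≢v (inj₂ (here refl))  = contradiction refl a≢v
Adj-∷-avoid a≢u a≢v (inj₂ (there vu∈G)) = inj₂ vu∈G

Adj-swap : Adj ((a , b) ∷ G) u v → Adj ((b , a) ∷ G) u v
Adj-swap (inj₁ (here refl))  = inj₂ (here refl)
Adj-swap (inj₁ (there uv∈G)) = inj₁ (there uv∈G)
Adj-swap (inj₂ (here refl))  = inj₁ (here refl)
Adj-swap (inj₂ (there vu∈G)) = inj₂ (there vu∈G)

Adj-irrefl : Loopless E → Adj E u v → u ≢ v
Adj-irrefl loopless (inj₁ uv∈E) u≡v = All.lookup loopless uv∈E u≡v
Adj-irrefl loopless (inj₂ vu∈E) u≡v = All.lookup loopless vu∈E (sym u≡v)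

Reach⇒Walk : Reach E u v → Walk E u v
Reach⇒Walk here       = ε
Reach⇒Walk (step r p) = r ◅ Reach⇒Walk p

Walk-sym : Walk E u v → Walk E v u
Walk-sym = Star.reverse Adj-sym

Walk-∷ : ∀ {e} → Walk E u v → Walk (e ∷ E) u v
Walk-∷ = Star.map Adj-∷

Walk-[] : Walk {k} [] u v → u ≡ v
Walk-[] ε                 = refl
Walk-[] (inj₁ () ◅ _)
Walk-[] (inj₂ () ◅ _)

Acyclic-[] : Acyclic {k} []
Acyclic-[] (_ , []    , () , _)
Acyclic-[] (_ , _ ∷ _ , _  , _ , inj₁ () ∷ _)
Acyclic-[] (_ , _ ∷ _ , _  , _ , inj₂ () ∷ _)

Walk⇒HasCycle : Walk G a b → a ≢ b → ¬ Adj G a b → HasCycle ((a , b) ∷ G)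
Walk⇒HasCycle walk a≢b ¬ab with loop-erase Fin._≟_ walk
... | []               , []         , _  = contradiction refl a≢b
... | _ ∷ []           , ab ∷ []    , _  = contradiction ab ¬ab
... | vs@(_ ∷ _ ∷ _)   , path       , un =
  _ , vs , s≤s (s≤s z≤n) , un , Path-close (Path-map Adj-∷ path) (inj₂ (here refl))

Linked-avoid : ∀ {L} → All (a ≢_) L → Linked (Adj ((a , b) ∷ G)) L → Linked (Adj G) L
Linked-avoid _                 []      = []
Linked-avoid _                 [-]     = [-]
Linked-avoid (a≢x ∷ a≢y ∷ a∉L) (r ∷ l) = Adj-∷-avoid a≢x a≢y r ∷ Linked-avoid (a≢y ∷ a∉L) l

Linked-old⊎Walk : ∀ vs → All (a ≢_) (v ∷ vs) → Linked (Adj ((a , b) ∷ G)) (v ∷ vs ++ [ a ]) →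
                    Linked (Adj G) (v ∷ vs ++ [ a ]) ⊎ Walk G v b
Linked-old⊎Walk [] (a≢v ∷ []) (r ∷ [-]) with Adj-∷⁻ r
... | inj₁ old                = inj₁ (old ∷ [-])
... | inj₂ (inj₁ (v≡a , _))   = contradiction (sym v≡a) a≢v
... | inj₂ (inj₂ (v≡b , _))   = inj₂ (subst (Walk _ _) v≡b ε)
Linked-old⊎Walk (_ ∷ vs) (a≢v ∷ a∉) (r ∷ l) with Adj-∷⁻ r
... | inj₁ old                = Sum.map (old ∷_) (old ◅_) (Linked-old⊎Walk vs a∉ l)
... | inj₂ (inj₁ (v≡a , _))   = contradiction (sym v≡a) a≢v
... | inj₂ (inj₂ (_ , v′≡a))  = contradiction (sym v′≡a) (All.head a∉)

-- Of the two cycle edges at a at most one is the new edge {a , b}; if one is, the rest of the cycle is an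
-- old walk between a and b, and otherwise the whole cycle is old.
no-cycle-through : Acyclic G → ¬ Walk G a b → ∀ {vs} → ¬ Cycle (Adj ((a , b) ∷ G)) a vs
no-cycle-through _ _ {[]}     (() , _)
no-cycle-through _ _ {_ ∷ []} (s≤s () , _)
no-cycle-through {G = G} {a} {b} acyclic a↛b {v ∷ v′ ∷ us}
                 (len , un@((a≢v ∷ a∉) ∷ (v∉ ∷ _)) , first ∷ rest) with Adj-∷⁻ first
... | inj₁ old = [ (λ rest′ → acyclic (a , _ , len , un , old ∷ rest′)) , (λ v↝b → a↛b (old ◅ v↝b)) ]′
                   (Linked-old⊎Walk (v′ ∷ us) (a≢v ∷ a∉) rest)
... | inj₂ (inj₂ (a≡b , _)) = a↛b (subst (Walk G a) a≡b ε)
... | inj₂ (inj₁ (_ , v≡b)) with rest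
...   | second ∷ rest′ = a↛b (Walk-sym (subst (λ t → Walk G t a) v≡b (second′ ◅ Linked⇒Star us rest″)))
  where
  second′ : Adj G v v′
  second′ = Adj-∷-avoid a≢v (All.head a∉) second
  b∉ : All (b ≢_) (v′ ∷ us ++ [ a ])
  b∉ = All-++⁺ (subst (λ t → All (t ≢_) (v′ ∷ us)) v≡b v∉) ((λ b≡a → a↛b (subst (Walk G a) (sym b≡a) ε)) ∷ [])
  rest″ : Linked (Adj G) (v′ ∷ us ++ [ a ])
  rest″ = Linked-avoid b∉ (Linked.map Adj-swap rest′)

Acyclic-∷ : Acyclic G → ¬ Walk G a b → Acyclic ((a , b) ∷ G)
Acyclic-∷ {a = a} acyclic a↛b (x , xs , cycle@(len , un , l)) with any? (a Fin.≟_) (x ∷ xs)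
... | yes a∈ = no-cycle-through acyclic a↛b (proj₂ (Cycle-rotate a∈ cycle))
... | no  a∉ = acyclic (x , xs , len , un , Linked-avoid (All-++⁺ (¬Any⇒All¬ _ a∉) (a∉ ∘ here ∷ [])) l)

AdjIn : EdgeList k → Pred (Fin k) p → Rel (Fin k) p
AdjIn E D x y = Adj E x y × D x × D y

AdjIn-sym : ∀ {D : Pred (Fin k) p} → AdjIn E D x y → AdjIn E D y x
AdjIn-sym (xy , Dx , Dy) = Adj-sym xy , Dy , Dx

unique-neighbour : ∀ {D : Pred (Fin k) p} → Acyclic E → Star (AdjIn E D) u y → ¬ D w →
                   Adj E w u → Adj E y w → u ≡ y
unique-neighbour {E = E} {u = u} {w = w} {D = D} acyclic walk w∉D wu yw with loop-erase Fin._≟_ walk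
... | []         , []                         , _  = refl
... | vs@(_ ∷ _) , path@((_ , u∈D , _) ∷ _) , un =
  contradiction (w , u ∷ vs , s≤s (s≤s z≤n) , (w≢ u∈D ∷ All.map w≢ (Path-targets (proj₂ ∘ proj₂) path)) ∷ un ,
                 wu ∷ Path-close (Path-map proj₁ path) yw)
                acyclic
  where
  w≢ : D x → w ≢ x
  w≢ Dx w≡x = w∉D (subst D (sym w≡x) Dx)

-- Component labellings

-- The vertices that are their own label are one per component, so c is the number of components.
record ComponentLabelling {n} (G : EdgeList n) (c : ℕ) : Set where
  field
    label          : Fin n → Fin n
    reaches-label  : ∀ v → Walk G v (label v)
    label-constant : ∀ {u v} → Walk G u v → label u ≡ label v
    roots          : count (λ v → label v Fin.≟ v) ≡ c

  label-idem : ∀ v → label (label v) ≡ label v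
  label-idem v = sym (label-constant (reaches-label v))

  same-label⇒Walk : ∀ {u v} → label u ≡ label v → Walk G u v
  same-label⇒Walk {u} {v} eq =
    reaches-label u ◅◅ subst (λ l → Walk G l v) (sym eq) (Walk-sym (reaches-label v))

  reach? : (u v : Fin n) → Dec (Walk G u v)
  reach? u v = map′ same-label⇒Walk label-constant (label u Fin.≟ label v)

module _ {n} {G : EdgeList n} {c} (L : ComponentLabelling G c) where
  open ComponentLabelling L

  1≤components : Fin n → 1 ≤ c
  1≤components x = begin
    1                                 ≡⟨ count-singleton (label x) ⟨
    count (Fin._≟ label x)            ≤⟨ count-mono (Fin._≟ label x) (λ v → label v Fin.≟ v) is-root ⟩
    count (λ v → label v Fin.≟ v)     ≡⟨ roots ⟩
    c                                 ∎
    where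
    open ≤-Reasoning
    is-root : ∀ {v} → v ≡ label x → label v ≡ v
    is-root refl = label-idem x

  connected⇒components≤1 : ∀ {x} → (∀ v → Walk G x v) → c ≤ 1
  connected⇒components≤1 {x} connected = begin
    c                                 ≡⟨ roots ⟨
    count (λ v → label v Fin.≟ v)     ≤⟨ count-mono (λ v → label v Fin.≟ v) (Fin._≟ label x) root≡ ⟩
    count (Fin._≟ label x)            ≡⟨ count-singleton (label x) ⟩
    1                                 ∎
    where
    open ≤-Reasoning
    root≡ : ∀ {v} → label v ≡ v → v ≡ label x
    root≡ {v} lv≡v = trans (sym lv≡v) (sym (label-constant (connected v)))

discrete-labelling : ∀ {n} → ComponentLabelling {n} [] n
discrete-labelling = record
  { label          = id
  ; reaches-label  = λ _ → ε
  ; label-constant = Walk-[]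
  ; roots          = count-all (λ v → v Fin.≟ v) (λ _ → refl)
  }

module _ {n} {G : EdgeList n} {c} (L : ComponentLabelling G (suc c)) {a b} (a↛b : ¬ Walk G a b) where
  open ComponentLabelling L

  private
    relabel : Fin n → Fin n
    relabel l with l Fin.≟ label b
    ... | yes _ = label a
    ... | no  _ = l

    relabel-b : relabel (label b) ≡ label a
    relabel-b with label b Fin.≟ label b
    ... | yes _   = refl
    ... | no  ≢lb = contradiction refl ≢lb

    relabel-other : ∀ {l} → l ≢ label b → relabel l ≡ l
    relabel-other {l} l≢lb with l Fin.≟ label b
    ... | yes l≡lb = contradiction l≡lb l≢lb
    ... | no  _    = refl

    relabel-⊎ : ∀ l → relabel l ≡ label a ⊎ relabel l ≡ l
    relabel-⊎ l with l Fin.≟ label b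
    ... | yes _ = inj₁ refl
    ... | no  _ = inj₂ refl

    la≢lb : label a ≢ label b
    la≢lb = a↛b ∘ same-label⇒Walk

    reaches-relabel : ∀ v → Walk ((a , b) ∷ G) v (relabel (label v))
    reaches-relabel v with label v Fin.≟ label b
    ... | yes lv≡lb = Walk-∷ (same-label⇒Walk lv≡lb) ◅◅ inj₂ (here refl) ◅ Walk-∷ (reaches-label a)
    ... | no  _     = Walk-∷ (reaches-label v)

    relabel-step : ∀ {u v} → Adj ((a , b) ∷ G) u v → relabel (label u) ≡ relabel (label v)
    relabel-step uv with Adj-∷⁻ uv
    ... | inj₁ old                  = cong relabel (label-constant (old ◅ ε))
    ... | inj₂ (inj₁ (refl , refl)) = trans (relabel-other la≢lb) (sym relabel-b)
    ... | inj₂ (inj₂ (refl , refl)) = trans relabel-b (sym (relabel-other la≢lb))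

    relabel-constant : ∀ {u v} → Walk ((a , b) ∷ G) u v → relabel (label u) ≡ relabel (label v)
    relabel-constant ε        = refl
    relabel-constant (r ◅ rs) = trans (relabel-step r) (relabel-constant rs)

    lb-not-root : relabel (label (label b)) ≢ label b
    lb-not-root eq = la≢lb (trans (sym relabel-b) (trans (cong relabel (sym (label-idem b))) eq))

    root-kept : ∀ {v} → v ≢ label b → label v ≡ v → relabel (label v) ≡ v
    root-kept v≢lb lv≡v = trans (relabel-other (λ lv≡lb → v≢lb (trans (sym lv≡v) lv≡lb))) lv≡v

    root-reflected : ∀ {v} → relabel (label v) ≡ v → label v ≡ v
    root-reflected {v} eq with relabel-⊎ (label v)
    ... | inj₁ r≡la = trans (cong label v≡la) (trans (label-idem a) (sym v≡la))
      where
      v≡la : v ≡ label a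
      v≡la = trans (sym eq) r≡la
    ... | inj₂ r≡lv = trans (sym r≡lv) eq

  merge : ComponentLabelling ((a , b) ∷ G) c
  merge = record
    { label          = relabel ∘ label
    ; reaches-label  = reaches-relabel
    ; label-constant = relabel-constant
    ; roots          = suc-injective (trans (sym one-root-fewer) roots)
    }
    where
    one-root-fewer : count (λ v → label v Fin.≟ v) ≡ suc (count (λ v → relabel (label v) Fin.≟ v))
    one-root-fewer = count-insert (λ v → label v Fin.≟ v) (λ v → relabel (label v) Fin.≟ v)
                       (label-idem b) lb-not-root root-kept root-reflected

-- Positions

Ordered : ∀ {n} → EdgeList n → Set
Ordered = All (λ e → toℕ (proj₁ e) < toℕ (proj₂ e))

record Board {n} (G : EdgeList n) (c : ℕ) : Set where
  field
    ordered   : Ordered G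
    acyclic   : Acyclic G
    labelling : ComponentLabelling G c

Legal⇒separated : ∀ {e} → Ordered G → Legal G e → ¬ Walk G (proj₁ e) (proj₂ e)
Legal⇒separated {G = G} {e = a , b} ordered (a<b , ab∉G , acyclic) walk = acyclic (Walk⇒HasCycle walk a≢b ¬ab)
  where
  a≢b : a ≢ b
  a≢b a≡b = <-irrefl (cong toℕ a≡b) a<b
  ¬ab : ¬ Adj G a b
  ¬ab (inj₁ ab∈G) = ab∉G ab∈G
  ¬ab (inj₂ ba∈G) = <-asym a<b (All.lookup ordered ba∈G)

separated⇒Legal : Acyclic G → toℕ a < toℕ b → ¬ Walk G a b → Legal G (a , b)
separated⇒Legal acyclic a<b a↛b = a<b , (λ ab∈G → a↛b (inj₁ ab∈G ◅ ε)) , Acyclic-∷ acyclic a↛b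

joining-move : Acyclic G → ¬ Walk G x z → ∃ λ e → Legal G e × Adj (e ∷ G) x z
joining-move {G = G} {x} {z} acyclic x↛z with <-cmp (toℕ x) (toℕ z)
... | tri< x<z _ _ = (x , z) , separated⇒Legal acyclic x<z x↛z , inj₁ (here refl)
... | tri≈ _ x≡z _ = contradiction (subst (Walk G x) (Fin.toℕ-injective x≡z) ε) x↛z
... | tri> _ _ z<x = (z , x) , separated⇒Legal acyclic z<x (x↛z ∘ Walk-sym) , inj₂ (here refl)

connected⇒Ended : Ordered G → (∀ y → Walk G x y) → Ended G
connected⇒Ended ordered connected _ legal = Legal⇒separated ordered legal (Walk-sym (connected _) ◅◅ connected _)

empty-board : ∀ {n} → Board {n} [] n
empty-board = record { ordered = [] ; acyclic = Acyclic-[] ; labelling = discrete-labelling }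

Board-∷ : ∀ {e c} → Board G (suc c) → Legal G e → Board (e ∷ G) c
Board-∷ board legal = record
  { ordered   = proj₁ legal ∷ ordered
  ; acyclic   = proj₂ (proj₂ legal)
  ; labelling = merge labelling (Legal⇒separated ordered legal)
  }
  where open Board board


2*[⌊n/2⌋+1]≤2+n : ∀ n → 2 * (⌊ n /2⌋ + 1) ≤ 2 + n
2*[⌊n/2⌋+1]≤2+n n = begin
  2 * (⌊ n /2⌋ + 1)         ≡⟨ 2*[h+1] ⌊ n /2⌋ ⟩
  2 + (⌊ n /2⌋ + ⌊ n /2⌋)   ≤⟨ +-monoʳ-≤ 2 (+-monoʳ-≤ ⌊ n /2⌋ (⌊n/2⌋≤⌈n/2⌉ n)) ⟩
  2 + (⌊ n /2⌋ + ⌈ n /2⌉)   ≡⟨ cong (2 +_) (⌊n/2⌋+⌈n/2⌉≡n n) ⟩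
  2 + n                     ∎
  where
  open ≤-Reasoning
  2*[h+1] : ∀ h → 2 * (h + 1) ≡ 2 + (h + h)
  2*[h+1] = solve-∀

m≤2*n+[1+o]⇒m<2*[1+n]+o : ∀ {K s c} → K ≤ 2 * s + suc c → K < 2 * suc s + c
m≤2*n+[1+o]⇒m<2*[1+n]+o {K} {s} {c} K≤ = subst (K <_) (sym (2*[1+s]+c s c)) (s≤s K≤)
  where
  2*[1+s]+c : ∀ s c → 2 * suc s + c ≡ suc (2 * s + suc c)
  2*[1+s]+c = solve-∀

2*m≤2*n+1⇒m≤n : ∀ {m n} → 2 * m ≤ 2 * n + 1 → m ≤ n
2*m≤2*n+1⇒m≤n {m} {n} 2m≤ = ≮⇒≥ λ n<m → <-irrefl refl (begin-strict
  2 * suc n   ≤⟨ *-monoʳ-≤ 2 n<m ⟩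
  2 * m       ≤⟨ 2m≤ ⟩
  2 * n + 1   <⟨ ≤-reflexive (sym (2*[1+n] n)) ⟩
  2 * suc n   ∎)
  where
  open ≤-Reasoning
  2*[1+n] : ∀ n → 2 * suc n ≡ suc (2 * n + 1)
  2*[1+n] = solve-∀

-- Partial copies of a tree

module Copies {n k : ℕ} {T : EdgeList k} (loopless : Loopless T) (T-acyclic : Acyclic T) where

  record PartialCopy (G : EdgeList n) : Set₁ where
    field
      Dom             : Pred (Fin k) 0ℓ
      Dom?            : Decidable Dom
      φ               : Fin k → Fin n
      root            : Fin k
      root∈Dom        : Dom root
      injective       : ∀ {u v} → Dom u → Dom v → φ u ≡ φ v → u ≡ v
      preserves-edges : ∀ {u v} → (u , v) ∈ T → Dom u → Dom v → Adj G (φ u) (φ v)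
      image-connected : ∀ {u} → Dom u → Walk G (φ root) (φ u)
      Dom-connected   : ∀ {u} → Dom u → Star (AdjIn T Dom) root u

    size : ℕ
    size = count Dom?

    anchor : Fin n
    anchor = φ root

  singleton-copy : ∀ {G} → Fin k → Fin n → PartialCopy G
  singleton-copy r x = record
    { Dom             = _≡ r
    ; Dom?            = Fin._≟ r
    ; φ               = const x
    ; root            = r
    ; root∈Dom        = refl
    ; injective       = λ u≡r v≡r _ → trans u≡r (sym v≡r)
    ; preserves-edges = λ { rr∈T refl refl → contradiction refl (All.lookup loopless rr∈T) }
    ; image-connected = λ _ → ε
    ; Dom-connected   = λ { refl → ε }
    }

  PartialCopy-∷ : ∀ {G e} → PartialCopy G → PartialCopy (e ∷ G)
  PartialCopy-∷ C = record
    { Dom             = Dom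
    ; Dom?            = Dom?
    ; φ               = φ
    ; root            = root
    ; root∈Dom        = root∈Dom
    ; injective       = injective
    ; preserves-edges = λ uv∈T u∈ v∈ → Adj-∷ (preserves-edges uv∈T u∈ v∈)
    ; image-connected = Walk-∷ ∘ image-connected
    ; Dom-connected   = Dom-connected
    }
    where open PartialCopy C

  PartialCopy⇒ContainsCopy : ∀ {G} (C : PartialCopy G) → (∀ v → PartialCopy.Dom C v) → ContainsCopy T G
  PartialCopy⇒ContainsCopy C full =
    φ , (λ φu≡φv → injective (full _) (full _) φu≡φv) , All.tabulate (λ uv∈T → preserves-edges uv∈T (full _) (full _))
    where open PartialCopy C

  module _ {G} (C : PartialCopy G) where
    open PartialCopy C

    module Extend {u w z} (u∈ : Dom u) (w∉ : ¬ Dom w) (uw : Adj T u w) (φu-z : Adj G (φ u) z)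
                  (fresh : ∀ {x} → Dom x → φ x ≢ z) where

      private
        Dom′ : Pred (Fin k) 0ℓ
        Dom′ v = v ≡ w ⊎ Dom v

        φ′ : Fin k → Fin n
        φ′ = updateAt φ w (const z)

        φ′-new : φ′ w ≡ z
        φ′-new = updateAt-updates w φ

        φ′-old : ∀ {x} → Dom x → φ′ x ≡ φ x
        φ′-old {x} x∈ = updateAt-minimal x w φ (λ x≡w → w∉ (subst Dom x≡w x∈))

        neighbour≡u : ∀ {y} → Dom y → Adj T y w → y ≡ u
        neighbour≡u y∈ yw = sym (unique-neighbour T-acyclic
          (Star.reverse AdjIn-sym (Dom-connected u∈) ◅◅ Dom-connected y∈) w∉ (Adj-sym uw) yw)

        injective′ : ∀ {x y} → Dom′ x → Dom′ y → φ′ x ≡ φ′ y → x ≡ y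
        injective′ (inj₁ refl) (inj₁ refl) _  = refl
        injective′ (inj₁ refl) (inj₂ y∈)   eq = contradiction (trans (sym (φ′-old y∈)) (trans (sym eq) φ′-new)) (fresh y∈)
        injective′ (inj₂ x∈)   (inj₁ refl) eq = contradiction (trans (sym (φ′-old x∈)) (trans eq φ′-new)) (fresh x∈)
        injective′ (inj₂ x∈)   (inj₂ y∈)   eq = injective x∈ y∈ (trans (sym (φ′-old x∈)) (trans eq (φ′-old y∈)))

        preserves-edges′ : ∀ {x y} → (x , y) ∈ T → Dom′ x → Dom′ y → Adj G (φ′ x) (φ′ y)
        preserves-edges′ ww∈T (inj₁ refl) (inj₁ refl) = contradiction refl (All.lookup loopless ww∈T)
        preserves-edges′ wy∈T (inj₁ refl) (inj₂ y∈)   =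
          subst₂ (Adj G) (sym φ′-new) (sym (trans (φ′-old y∈) (cong φ (neighbour≡u y∈ (inj₂ wy∈T))))) (Adj-sym φu-z)
        preserves-edges′ xw∈T (inj₂ x∈)   (inj₁ refl) =
          subst₂ (Adj G) (sym (trans (φ′-old x∈) (cong φ (neighbour≡u x∈ (inj₁ xw∈T))))) (sym φ′-new) φu-z
        preserves-edges′ xy∈T (inj₂ x∈)   (inj₂ y∈)   =
          subst₂ (Adj G) (sym (φ′-old x∈)) (sym (φ′-old y∈)) (preserves-edges xy∈T x∈ y∈)

        image-connected′ : ∀ {x} → Dom′ x → Walk G (φ′ root) (φ′ x)
        image-connected′ (inj₁ refl) =
          subst₂ (Walk G) (sym (φ′-old root∈Dom)) (sym φ′-new) (image-connected u∈ ◅◅ φu-z ◅ ε)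
        image-connected′ (inj₂ x∈) =
          subst₂ (Walk G) (sym (φ′-old root∈Dom)) (sym (φ′-old x∈)) (image-connected x∈)

        grow : ∀ {x y} → AdjIn T Dom x y → AdjIn T Dom′ x y
        grow (xy , x∈ , y∈) = xy , inj₂ x∈ , inj₂ y∈

        Dom-connected′ : ∀ {x} → Dom′ x → Star (AdjIn T Dom′) root x
        Dom-connected′ (inj₁ refl) = Star.map grow (Dom-connected u∈) ◅◅ (uw , inj₂ u∈ , inj₁ refl) ◅ ε
        Dom-connected′ (inj₂ x∈)   = Star.map grow (Dom-connected x∈)

      extended : PartialCopy G
      extended = record
        { Dom             = Dom′
        ; Dom?            = λ v → v Fin.≟ w ⊎-dec Dom? v
        ; φ               = φ′
        ; root            = root
        ; root∈Dom        = inj₂ root∈Dom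
        ; injective       = injective′
        ; preserves-edges = preserves-edges′
        ; image-connected = image-connected′
        ; Dom-connected   = Dom-connected′
        }

      size-extended : PartialCopy.size extended ≡ suc size
      size-extended = count-insert (PartialCopy.Dom? extended) Dom? (inj₁ refl) w∉
                        (λ v≢w → [ (λ v≡w → contradiction v≡w v≢w) , id ]′) inj₂

-- The strategy

module Strategy {m k : ℕ} (T : EdgeList k) (tree : IsTree T) where

  private
    n : ℕ
    n = suc m

    loopless : Loopless T
    loopless = proj₁ tree

    T-connected : Connected T
    T-connected = proj₁ (proj₂ tree)

    T-acyclic : Acyclic T
    T-acyclic = proj₂ (proj₂ tree)

  open Copies {n = n} loopless T-acyclic

  Slack : Bool → ℕ → Set
  Slack true  Φ = 2 * k ≤ Φ
  Slack false Φ = 2 * k < Φ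

  Slack⇒≤ : ∀ {b Φ} → Slack b Φ → 2 * k ≤ Φ
  Slack⇒≤ {true}  = id
  Slack⇒≤ {false} = <⇒≤

  record State (myTurn : Bool) (G : EdgeList n) (c : ℕ) : Set₁ where
    field
      board : Board G c
      copy  : PartialCopy G
      slack : Slack myTurn (2 * PartialCopy.size copy + c)

    open Board board public
    open PartialCopy copy public
    open ComponentLabelling labelling public using (reach?)

  copy-complete : ∀ {b G c} (s : State b G c) → (∀ v → Walk G (State.anchor s) v) → ∀ v → State.Dom s v
  copy-complete {c = c} s connected v = decidable-stable (Dom? v) λ v∉ →
    <⇒≱ (count<n Dom? v∉) (2*m≤2*n+1⇒m≤n (≤-trans (Slack⇒≤ slack) (+-monoʳ-≤ _ c≤1)))
    where
    open State s
    c≤1 : c ≤ 1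
    c≤1 = connected⇒components≤1 labelling connected

  opponent-move : ∀ {G c e} → State false G (suc c) → Legal G e → State true (e ∷ G) c
  opponent-move s legal = record
    { board = Board-∷ board legal
    ; copy  = PartialCopy-∷ copy
    ; slack = s≤s⁻¹ (subst (2 * k <_) (+-suc _ _) slack)
    }
    where open State s

  MyMove : EdgeList n → ℕ → Set₁
  MyMove G c = ∃ λ e → Legal G e × State false (e ∷ G) c

  module MyTurn {G c} (s : State true G (suc c)) where
    open State s

    closing-move : ∀ {z} → (∀ v → Dom v) → ¬ Walk G anchor z → MyMove G c
    closing-move full anchor↛z with joining-move acyclic anchor↛z
    ... | e , legal , _ = e , legal , record
      { board = board′
      ; copy  = PartialCopy-∷ copy
      ; slack = subst (λ t → 2 * k < 2 * t + c) (sym (count-all Dom? full))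
                      (m<m+n (2 * k) (1≤components (Board.labelling board′) zero))
      }
      where
      board′ : Board (e ∷ G) c
      board′ = Board-∷ board legal

    attaching-move : ∀ {u w z} → Dom u → ¬ Dom w → Adj T u w → ¬ Walk G anchor z → MyMove G c
    attaching-move {u} {w} {z} u∈ w∉ uw anchor↛z
      with joining-move acyclic (λ φu↝z → anchor↛z (image-connected u∈ ◅◅ φu↝z))
    ... | e , legal , φu-z = e , legal , record
      { board = Board-∷ board legal
      ; copy  = Extended.extended
      ; slack = subst (λ t → 2 * k < 2 * t + c) (sym Extended.size-extended) (m≤2*n+[1+o]⇒m<2*[1+n]+o slack)
      }
      where
      fresh : ∀ {x} → Dom x → φ x ≢ z
      fresh x∈ φx≡z = anchor↛z (subst (Walk G anchor) φx≡z (image-connected x∈))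
      module Extended = Extend (PartialCopy-∷ copy) u∈ w∉ uw φu-z fresh

    my-move : ∀ {z} → ¬ Walk G anchor z → MyMove G c
    my-move anchor↛z with all? Dom?
    ... | yes full = closing-move full anchor↛z
    ... | no ¬full with ¬∀⟶∃¬ k Dom Dom? ¬full
    ...   | v , v∉ with Star-exit Dom? (Reach⇒Walk (T-connected root v)) root∈Dom v∉
    ...     | _ , _ , uw , u∈ , w∉ = attaching-move u∈ w∉ uw anchor↛z

  wins : ∀ {b G} c → State b G c → Forces T b G
  wins c s with all? (State.reach? s (State.anchor s))
  ... | yes connected =
    done (connected⇒Ended (State.ordered s) connected) (PartialCopy⇒ContainsCopy (State.copy s) (copy-complete s connected))
  wins zero s | no _ = contradiction (1≤components (State.labelling s) zero) λ ()
  wins (suc c) s | no ¬connected with ¬∀⟶∃¬ n _ (State.reach? s (State.anchor s)) ¬connected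
  wins {true}  (suc c) s | no _ | _ , anchor↛z with MyTurn.my-move s anchor↛z
  ... | e , legal , s′ = mine e legal (wins c s′)
  wins {false} (suc c) s | no _ | _ , anchor↛z =
    theirs (Product.map₂ proj₁ (joining-move (State.acyclic s) anchor↛z)) (λ _ legal → wins c (opponent-move s legal))

  first-player-wins : 2 * k ≤ 2 + n → Fin k → Forces T true []
  first-player-wins 2k≤2+n r = wins n record
    { board = empty-board
    ; copy  = singleton-copy r zero
    ; slack = subst (λ t → 2 * k ≤ 2 * t + n) (sym (count-singleton r)) 2k≤2+n
    }

  second-player-wins : ∀ {x y t₁ t₂} → 2 * k ≤ 2 + n → Adj T t₁ t₂ → x ≢ y → Forces T false []
  second-player-wins {t₁ = t₁} 2k≤2+n t₁t₂ x≢y =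
    theirs (Product.map₂ proj₁ (joining-move Acyclic-[] (x≢y ∘ Walk-[]))) (λ _ legal → wins m (reply legal))
    where
    reply : ∀ {e} → Legal [] e → State true (e ∷ []) m
    reply {a , b} legal = record
      { board = Board-∷ empty-board legal
      ; copy  = Extended.extended
      ; slack = subst (λ t → 2 * k ≤ 2 * t + m) (sym (trans Extended.size-extended (cong suc (count-singleton t₁))))
                      (≤-trans 2k≤2+n (n≤1+n _))
      }
      where
      a≢b : ∀ {x} → x ≡ t₁ → a ≢ b
      a≢b _ a≡b = <-irrefl (cong toℕ a≡b) (proj₁ legal)
      module Extended = Extend (PartialCopy-∷ (singleton-copy t₁ a)) refl (Adj-irrefl loopless t₁t₂ ∘ sym)
                               t₁t₂ (inj₁ (here refl)) a≢b


lemma4p1 : (n : ℕ) → 2 ≤ n → (T : EdgeList (⌊ n /2⌋ + 1)) → IsTree T → (iStart : Bool) → Forces {n = n} T iStart []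
lemma4p1 n@(suc (suc m)) (s≤s (s≤s _)) T tree true  = Strategy.first-player-wins T tree (2*[⌊n/2⌋+1]≤2+n n) zero
lemma4p1 n@(suc (suc m)) (s≤s (s≤s _)) T tree false
  -- T has a vertex other than zero, hence an edge.
  with Star-first (Reach⇒Walk (proj₁ (proj₂ tree) zero (suc (⌊ m /2⌋ ↑ʳ zero)))) (λ ())
... | _ , _ , t₁t₂ = Strategy.second-player-wins T tree {x = zero} {y = suc zero} (2*[⌊n/2⌋+1]≤2+n n) t₁t₂ (λ ())
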